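{- Let $(G,k)$ be an instance of CTVD and let $S$ be a (clique, tree)-deletion set of $G$ with $|S| \le 4k$. Let $V_1$ be the union of the vertex sets of the connected components of $G-S$ that are cliques with at least $3$ vertices, and $V_2 = V(G) \setminus (S \cup V_1)$. Let $C$ be a connected component of $G[V_2]$ and suppose there are $x \in S$ and $u \in C$ such that $N_G(C) = \{x\}$ and $N_G(x) \cap C = \{u\}$. Let $G'$ be obtained from $G$ by deleting all vertices of $C \setminus \{u\}$. Then $(G,k)$ is a yes-instance if and only if $(G',k)$ is a yes-instance.
   Context: CTVD: given a multigraph $G$ (loops and parallel edges allowed) and an integer $k$, decide whether there is $S\subseteq V(G)$ with $|S|\le k$ such that $G-S$ is simple and every connected component of $G-S$ is a clique or a tree. A (clique, tree)-deletion set of $G$ is any $X \subseteq V(G)$ such that $G - X$ is simple and each of its connected components is a clique or a tree. $N_G(C)$ denotes the set of vertices outside $C$ having a neighbor in $C$. -}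

module Defs where

open import Data.Nat using (ℕ; zero; suc; _≤_; _<_; _+_)
open import Data.Fin using (Fin; zero; suc; inject₁; fromℕ)
open import Data.Fin.Subset using (Subset; _∈_; _∉_; _⊆_; ∁; _∩_; ∣_∣)
open import Data.Product using (Σ; ∃; _×_; _,_)
open import Data.Sum using (_⊎_)
open import Relation.Binary.PropositionalEquality using (_≡_; _≢_)
open import Relation.Nullary using (¬_)
open import Function.Definitions using (Injective)

-- A finite multigraph on vertex set Fin n: mult u v = number of edges
-- between u and v (mult v v = number of loops at v).
record MultiGraph (n : ℕ) : Set where
  field
    mult : Fin n → Fin n → ℕ
    mult-sym : ∀ u v → mult u v ≡ mult v u
open MultiGraph public

Adj : ∀ {n} → MultiGraph n → Fin n → Fin n → Set
Adj G u v = 0 < mult G u v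

data Reach {n} (G : MultiGraph n) (U : Subset n) : Fin n → Fin n → Set where
  here : ∀ {v} → v ∈ U → Reach G U v v
  step : ∀ {u v w} → Reach G U u v → Adj G v w → w ∈ U → Reach G U u w

IsComponent : ∀ {n} → MultiGraph n → Subset n → Subset n → Set
IsComponent {n} G U C =
  Σ (Fin n) λ r → r ∈ C × (∀ v → (v ∈ C → Reach G U r v) × (Reach G U r v → v ∈ C))

IsSimple : ∀ {n} → MultiGraph n → Subset n → Set
IsSimple G U = (∀ v → v ∈ U → mult G v v ≡ 0)
             × (∀ u v → u ∈ U → v ∈ U → mult G u v ≤ 1)

IsClique : ∀ {n} → MultiGraph n → Subset n → Set
IsClique G C = ∀ u v → u ∈ C → v ∈ C → u ≢ v → Adj G u v

HasCycle : ∀ {n} → MultiGraph n → Subset n → Set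
HasCycle {n} G C =
  Σ ℕ λ l → Σ (Fin (suc (suc (suc l))) → Fin n) λ f →
    Injective _≡_ _≡_ f
    × (∀ i → f i ∈ C)
    × (∀ (i : Fin (suc (suc l))) → Adj G (f (inject₁ i)) (f (suc i)))
    × Adj G (f (fromℕ (suc (suc l)))) (f zero)

IsTree : ∀ {n} → MultiGraph n → Subset n → Set
IsTree {n} G C = (Σ (Fin n) λ v → v ∈ C)
               × (∀ u v → u ∈ C → v ∈ C → Reach G C u v)
               × ¬ HasCycle G C

-- X is a (clique, tree)-deletion set of the induced subgraph G[W]:
-- X ⊆ W, G[W] - X is simple and every component is a clique or a tree
IsCTDS : ∀ {n} → MultiGraph n → Subset n → Subset n → Set
IsCTDS G W X = X ⊆ W
             × IsSimple G (W ∩ ∁ X)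
             × (∀ D → IsComponent G (W ∩ ∁ X) D → IsClique G D ⊎ IsTree G D)

YesInstance : ∀ {n} → MultiGraph n → Subset n → ℕ → Set
YesInstance G W k = ∃ λ X → IsCTDS G W X × ∣ X ∣ ≤ k

InV₁ : ∀ {n} → MultiGraph n → Subset n → Fin n → Set
InV₁ G S v = ∃ λ D → IsComponent G (∁ S) D × IsClique G D × 3 ≤ ∣ D ∣ × v ∈ D

module Submission where

-- Deleting vertices keeps a (clique, tree)-deletion set a deletion set of the smaller induced graph,
-- which gives one direction. For the other, C is a component of G - S, so it is a tree (a clique
-- with a cycle would have 3 vertices and put C into V₁), and every edge leaving C - u ends at u.
-- Let X be a deletion set of G - (C - u) and D a component of G - X meeting C - u. If u ∈ X then
-- D ⊆ C - u is a tree. Otherwise, since a cycle minus u stays connected, every cycle of D lies in C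
-- or in the component D ∖ (C - u) of the reduced graph; the latter is a tree, or a clique inside
-- {u, x}, which has no cycle either. So X is a deletion set of G as well.

open import Defs
open import Data.Nat using (ℕ; zero; suc; _≤_; _<_; _+_; _*_; z≤n; s≤s; _<?_)
open import Data.Nat.Properties
  using (≤-refl; ≤-trans; ≤-reflexive; <⇒≤; <⇒≱; ≮⇒≥; n≤1+n; m≤m+n; +-suc; +-monoʳ-≤; module ≤-Reasoning)
open import Data.Fin using (Fin; zero; suc; toℕ; inject₁; fromℕ; _≟_)
open import Data.Fin.Properties using (any?; <-cmp; ≤̄⇒inject₁<)
open import Data.Fin.Subset
  using (Subset; inside; outside; _∈_; _∉_; _⊆_; ⊤; ⁅_⁆; ∁; _∩_; _∪_; _─_; _-_; ∣_∣)
open import Data.Fin.Subset.Properties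
  using (_∈?_; ∈⊤; x∈⁅x⁆; x∈⁅y⁆⇒x≡y; x≢y⇒x∉⁅y⁆; x∈∁p⇒x∉p; x∉p⇒x∈∁p; x∈p∩q⁺; x∈p∩q⁻; p∩q⊆q;
         x∈p∪q⁺; x∈p∪q⁻; p─q⊆p; x∈p∧x≢y⇒x∈p-y; ∩-identityˡ;
         ∣⁅x⁆∣≡1; x∈p⇒∣p-x∣<∣p∣; p⊆q⇒∣p∣≤∣q∣; p⊂q⇒∣p∣<∣q∣; ∣p∣≤n; ∣p∩q∣≤∣p∣)
open import Data.Vec using (_∷_; []; here; there)
open import Data.Product using (∃; _×_; _,_; proj₁; proj₂)
open import Data.Sum using (_⊎_; inj₁; inj₂)
open import Data.Empty using (⊥-elim)
open import Function using (_∘_)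
open import Function.Bundles using (_⇔_; mk⇔)
open import Function.Definitions using (Injective)
open import Relation.Binary.Definitions using (tri<; tri≈; tri>)
open import Relation.Binary.PropositionalEquality using (_≡_; _≢_; refl; sym; trans; subst; cong₂)
open import Relation.Nullary using (¬_; Dec; yes; no; contradiction)
open import Relation.Nullary.Decidable using (_×-dec_; ¬?)

x∈p∩∁q⁺ : ∀ {n} {p q : Subset n} {x} → x ∈ p → x ∉ q → x ∈ p ∩ ∁ q
x∈p∩∁q⁺ x∈p x∉q = x∈p∩q⁺ (x∈p , x∉p⇒x∈∁p x∉q)

x∈p∩∁q⁻ : ∀ {n} {p q : Subset n} {x} → x ∈ p ∩ ∁ q → x ∈ p × x ∉ q
x∈p∩∁q⁻ {p = p} {q} x∈ with x∈p∩q⁻ p (∁ q) x∈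
... | x∈p , x∈∁q = x∈p , x∈∁p⇒x∉p x∈∁q

x∈p─q⇒x∉q : ∀ {n} {p q : Subset n} {x} → x ∈ p ─ q → x ∉ q
x∈p─q⇒x∉q {p = inside ∷ p} {outside ∷ q} here ()
x∈p─q⇒x∉q {p = _ ∷ p} {_ ∷ q} (there x∈) (there x∈q) = x∈p─q⇒x∉q x∈ x∈q

x∈p-y⇒x≢y : ∀ {n} {p : Subset n} {x y} → x ∈ p - y → x ≢ y
x∈p-y⇒x≢y {y = y} x∈ refl = x∈p─q⇒x∉q x∈ (x∈⁅x⁆ y)

∣p∪q∣≤∣p∣+∣q∣ : ∀ {n} (p q : Subset n) → ∣ p ∪ q ∣ ≤ ∣ p ∣ + ∣ q ∣
∣p∪q∣≤∣p∣+∣q∣ []            []            = z≤n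
∣p∪q∣≤∣p∣+∣q∣ (inside  ∷ p) (inside  ∷ q) =
  s≤s (≤-trans (∣p∪q∣≤∣p∣+∣q∣ p q) (+-monoʳ-≤ ∣ p ∣ (n≤1+n ∣ q ∣)))
∣p∪q∣≤∣p∣+∣q∣ (inside  ∷ p) (outside ∷ q) = s≤s (∣p∪q∣≤∣p∣+∣q∣ p q)
∣p∪q∣≤∣p∣+∣q∣ (outside ∷ p) (inside  ∷ q) =
  ≤-trans (s≤s (∣p∪q∣≤∣p∣+∣q∣ p q)) (≤-reflexive (sym (+-suc ∣ p ∣ ∣ q ∣)))
∣p∪q∣≤∣p∣+∣q∣ (outside ∷ p) (outside ∷ q) = ∣p∪q∣≤∣p∣+∣q∣ p q

three-distinct⇒3≤∣p∣ : ∀ {n} {p : Subset n} {a b c} →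
  a ∈ p → b ∈ p → c ∈ p → a ≢ b → a ≢ c → b ≢ c → 3 ≤ ∣ p ∣
three-distinct⇒3≤∣p∣ {p = p} {a} {b} {c} a∈p b∈p c∈p a≢b a≢c b≢c = begin
  3                                  ≤⟨ s≤s (s≤s (s≤s z≤n)) ⟩
  suc (suc (suc ∣ p - a - b - c ∣))  ≤⟨ s≤s (s≤s (x∈p⇒∣p-x∣<∣p∣ c∈p-a-b)) ⟩
  suc (suc ∣ p - a - b ∣)            ≤⟨ s≤s (x∈p⇒∣p-x∣<∣p∣ (x∈p∧x≢y⇒x∈p-y b∈p (a≢b ∘ sym))) ⟩
  suc ∣ p - a ∣                      ≤⟨ x∈p⇒∣p-x∣<∣p∣ a∈p ⟩
  ∣ p ∣                              ∎
  where
  open ≤-Reasoning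
  c∈p-a-b : c ∈ p - a - b
  c∈p-a-b = x∈p∧x≢y⇒x∈p-y (x∈p∧x≢y⇒x∈p-y c∈p (a≢c ∘ sym)) (b≢c ∘ sym)

module _ {n} (G : MultiGraph n) where

  Adj-sym : ∀ {a b} → Adj G a b → Adj G b a
  Adj-sym {a} {b} = subst (0 <_) (mult-sym G a b)

  Adj? : ∀ a b → Dec (Adj G a b)
  Adj? a b = 0 <? mult G a b

  Reach-source∈ : ∀ {U a b} → Reach G U a b → a ∈ U
  Reach-source∈ (here a∈U)  = a∈U
  Reach-source∈ (step p _ _) = Reach-source∈ p

  Reach-target∈ : ∀ {U a b} → Reach G U a b → b ∈ U
  Reach-target∈ (here b∈U)     = b∈U
  Reach-target∈ (step _ _ b∈U) = b∈U

  Reach-trans : ∀ {U a b c} → Reach G U a b → Reach G U b c → Reach G U a c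
  Reach-trans p (here _)       = p
  Reach-trans p (step q e c∈U) = step (Reach-trans p q) e c∈U

  Reach-sym : ∀ {U a b} → Reach G U a b → Reach G U b a
  Reach-sym (here a∈U)       = here a∈U
  Reach-sym (step p e b∈U) =
    Reach-trans (step (here b∈U) (Adj-sym e) (Reach-target∈ p)) (Reach-sym p)

  Reach-mono : ∀ {U V a b} → U ⊆ V → Reach G U a b → Reach G V a b
  Reach-mono U⊆V (here a∈U)     = here (U⊆V a∈U)
  Reach-mono U⊆V (step p e b∈U) = step (Reach-mono U⊆V p) e (U⊆V b∈U)

  Reach-restrict : ∀ {U D a b} → (∀ {w} → Reach G U a w → w ∈ D) → Reach G U a b → Reach G D a b
  Reach-restrict inD (here a∈U)     = here (inD (here a∈U))
  Reach-restrict inD (step p e b∈U) = step (Reach-restrict inD p) e (inD (step p e b∈U))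

  module Component {U D : Subset n} (D-comp : IsComponent G U D) where

    root : Fin n
    root = proj₁ D-comp

    root∈ : root ∈ D
    root∈ = proj₁ (proj₂ D-comp)

    reach-root : ∀ {v} → v ∈ D → Reach G U root v
    reach-root v∈D = proj₁ (proj₂ (proj₂ D-comp) _) v∈D

    reach-root⇒∈ : ∀ {v} → Reach G U root v → v ∈ D
    reach-root⇒∈ = proj₂ (proj₂ (proj₂ D-comp) _)

    ⊆U : D ⊆ U
    ⊆U = Reach-target∈ ∘ reach-root

    closed : ∀ {v w} → v ∈ D → Reach G U v w → w ∈ D
    closed v∈D p = reach-root⇒∈ (Reach-trans (reach-root v∈D) p)

    connected : ∀ {v w} → v ∈ D → w ∈ D → Reach G D v w
    connected v∈D w∈D =
      Reach-restrict (closed v∈D) (Reach-trans (Reach-sym (reach-root v∈D)) (reach-root w∈D))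

  -- Exploration from r adds one frontier vertex per step; the invariant n ≤ fuel + ∣ R ∣ rules out
  -- a frontier once the fuel is spent.
  module _ (U : Subset n) (r : Fin n) where

    private
      Frontier : Subset n → Fin n → Set
      Frontier R w = w ∈ U × w ∉ R × ∃ λ v → v ∈ R × Adj G v w

      frontier? : ∀ R → Dec (∃ (Frontier R))
      frontier? R = any? λ w → w ∈? U ×-dec ¬? (w ∈? R) ×-dec any? (λ v → v ∈? R ×-dec Adj? v w)

      explore : ∀ fuel R → n ≤ fuel + ∣ R ∣ → r ∈ R → (∀ {v} → v ∈ R → Reach G U r v) →
                ∃ λ D → IsComponent G U D × r ∈ D
      explore fuel R bound r∈R sound with frontier? R
      ... | no no-frontier = R , (r , r∈R , λ _ → sound , complete) , r∈R
        where
        complete : ∀ {v} → Reach G U r v → v ∈ R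
        complete (here _) = r∈R
        complete (step {w = w} p e w∈U) with w ∈? R
        ... | yes w∈R = w∈R
        ... | no w∉R  = ⊥-elim (no-frontier (w , w∈U , w∉R , _ , complete p , e))
      ... | yes (w , w∈U , w∉R , v , v∈R , e) = continue fuel bound
        where
        R′ : Subset n
        R′ = ⁅ w ⁆ ∪ R

        R⊆R′ : R ⊆ R′
        R⊆R′ = x∈p∪q⁺ ∘ inj₂

        grows : ∣ R ∣ < ∣ R′ ∣
        grows = p⊂q⇒∣p∣<∣q∣ (R⊆R′ , w , x∈p∪q⁺ (inj₁ (x∈⁅x⁆ w)) , w∉R)

        sound′ : ∀ {v} → v ∈ R′ → Reach G U r v
        sound′ v∈R′ with x∈p∪q⁻ ⁅ w ⁆ R v∈R′
        ... | inj₁ v∈⁅w⁆ = subst (Reach G U r) (sym (x∈⁅y⁆⇒x≡y w v∈⁅w⁆)) (step (sound v∈R) e w∈U)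
        ... | inj₂ v∈R   = sound v∈R

        continue : ∀ fuel → n ≤ fuel + ∣ R ∣ → ∃ λ D → IsComponent G U D × r ∈ D
        continue zero    bound = contradiction (≤-trans (∣p∣≤n R′) bound) (<⇒≱ grows)
        continue (suc f) bound = explore f R′ bound′ (R⊆R′ r∈R) sound′
          where
          open ≤-Reasoning
          bound′ : n ≤ f + ∣ R′ ∣
          bound′ = begin
            n                ≤⟨ bound ⟩
            suc (f + ∣ R ∣)  ≡⟨ sym (+-suc f ∣ R ∣) ⟩
            f + suc ∣ R ∣    ≤⟨ +-monoʳ-≤ f grows ⟩
            f + ∣ R′ ∣       ∎

    component-of : r ∈ U → ∃ λ D → IsComponent G U D × r ∈ D
    component-of r∈U = explore n ⁅ r ⁆ (m≤m+n n _) (x∈⁅x⁆ r) single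
      where
      single : ∀ {v} → v ∈ ⁅ r ⁆ → Reach G U r v
      single v∈⁅r⁆ = subst (Reach G U r) (sym (x∈⁅y⁆⇒x≡y r v∈⁅r⁆)) (here r∈U)

  component-restrict : ∀ {U U′ D} → IsComponent G U D → D ⊆ U′ → U′ ⊆ U → IsComponent G U′ D
  component-restrict D-comp D⊆U′ U′⊆U =
    root , root∈ , λ _ → Reach-restrict (D⊆U′ ∘ closed root∈) ∘ reach-root , reach-root⇒∈ ∘ Reach-mono U′⊆U
    where open Component D-comp

  component-extend : ∀ {U U′ D} → IsComponent G U D → U ⊆ U′ →
                     (∀ {v w} → v ∈ D → Reach G U′ v w → w ∈ U) → IsComponent G U′ D
  component-extend D-comp U⊆U′ stays =
    root , root∈ , λ _ → Reach-mono U⊆U′ ∘ reach-root , reach-root⇒∈ ∘ Reach-restrict (stays root∈)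
    where open Component D-comp

  HasCycle-mono : ∀ {D E} → D ⊆ E → HasCycle G D → HasCycle G E
  HasCycle-mono D⊆E (l , f , f-inj , f∈D , adj , closing) = l , f , f-inj , D⊆E ∘ f∈D , adj , closing

  cycle⇒3≤∣∣ : ∀ {D} → HasCycle G D → 3 ≤ ∣ D ∣
  cycle⇒3≤∣∣ (_ , _ , f-inj , f∈D , _) =
    three-distinct⇒3≤∣p∣ (f∈D zero) (f∈D (suc zero)) (f∈D (suc (suc zero)))
      ((λ ()) ∘ f-inj) ((λ ()) ∘ f-inj) ((λ ()) ∘ f-inj)

  acyclic-component⇒tree : ∀ {U D} → IsComponent G U D → ¬ HasCycle G D → IsTree G D
  acyclic-component⇒tree D-comp acyclic = (root , root∈) , (λ _ _ → connected) , acyclic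
    where open Component D-comp

  clique-or-tree-⊆ : ∀ {U D B} → IsComponent G U D → D ⊆ B →
                     IsClique G B ⊎ IsTree G B → IsClique G D ⊎ IsTree G D
  clique-or-tree-⊆ _      D⊆B (inj₁ clique) = inj₁ λ a b a∈D b∈D → clique a b (D⊆B a∈D) (D⊆B b∈D)
  clique-or-tree-⊆ D-comp D⊆B (inj₂ (_ , _ , acyclic)) =
    inj₂ (acyclic-component⇒tree D-comp (acyclic ∘ HasCycle-mono D⊆B))

  IsSimple-mono : ∀ {U V} → U ⊆ V → IsSimple G V → IsSimple G U
  IsSimple-mono U⊆V (no-loop , no-parallel) =
    (λ v v∈U → no-loop v (U⊆V v∈U)) , λ a b a∈U b∈U → no-parallel a b (U⊆V a∈U) (U⊆V b∈U)

  IsCTDS-restrict : ∀ {W W′ X} → W′ ⊆ W → IsCTDS G W X → IsCTDS G W′ (X ∩ W′)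
  IsCTDS-restrict {W} {W′} {X} W′⊆W (_ , X-simple , X-comps) =
    p∩q⊆q X W′ , IsSimple-mono remaining⊆ X-simple , comps
    where
    remaining⊆ : W′ ∩ ∁ (X ∩ W′) ⊆ W ∩ ∁ X
    remaining⊆ v∈ with x∈p∩∁q⁻ v∈
    ... | v∈W′ , v∉X∩W′ = x∈p∩∁q⁺ (W′⊆W v∈W′) λ v∈X → v∉X∩W′ (x∈p∩q⁺ (v∈X , v∈W′))

    comps : ∀ D → IsComponent G (W′ ∩ ∁ (X ∩ W′)) D → IsClique G D ⊎ IsTree G D
    comps D D-comp =
      let B , B-comp , root∈B = component-of _ root (remaining⊆ (⊆U root∈))
      in  clique-or-tree-⊆ D-comp (Component.closed B-comp root∈B ∘ Reach-mono remaining⊆ ∘ reach-root)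
                           (X-comps B B-comp)
      where open Component D-comp

  YesInstance-mono : ∀ {W W′ k} → W′ ⊆ W → YesInstance G W k → YesInstance G W′ k
  YesInstance-mono {W′ = W′} W′⊆W (X , X-ctds , X≤k) =
    X ∩ W′ , IsCTDS-restrict W′⊆W X-ctds , ≤-trans (∣p∩q∣≤∣p∣ X W′) X≤k

  prefix-reach : ∀ {M W} (f : Fin (suc M) → Fin n) → (∀ i → Adj G (f (inject₁ i)) (f (suc i))) →
                 ∀ i → (∀ t → toℕ t ≤ toℕ i → f t ∈ W) → Reach G W (f zero) (f i)
  prefix-reach f adj zero    inW = here (inW zero z≤n)
  prefix-reach {suc M} f adj (suc i) inW =
    step (prefix-reach (f ∘ inject₁) (adj ∘ inject₁) i λ t t≤i → inW (inject₁ t) (<⇒≤ (≤̄⇒inject₁< t≤i)))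
         (adj i) (inW (suc i) ≤-refl)

  suffix-reach : ∀ {M W} (f : Fin (suc M) → Fin n) → (∀ i → Adj G (f (inject₁ i)) (f (suc i))) →
                 ∀ i → (∀ t → toℕ i ≤ toℕ t → f t ∈ W) → Reach G W (f i) (f (fromℕ M))
  suffix-reach {zero}  f adj zero    inW = here (inW zero z≤n)
  suffix-reach {suc M} f adj zero    inW =
    Reach-trans (step (here (inW zero z≤n)) (adj zero) (inW (suc zero) z≤n))
                (suffix-reach (f ∘ suc) (adj ∘ suc) zero λ t _ → inW (suc t) z≤n)
  suffix-reach {suc M} f adj (suc i) inW =
    suffix-reach (f ∘ suc) (adj ∘ suc) i λ t i≤t → inW (suc t) (s≤s i≤t)

  -- A cycle vertex other than u reaches f zero along the prefix of the cycle or f (fromℕ M) along the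
  -- suffix, whichever misses u; these two ends are adjacent.
  module _ {M} {f : Fin (suc M) → Fin n} (f-inj : Injective _≡_ _≡_ f)
           (adj : ∀ i → Adj G (f (inject₁ i)) (f (suc i))) (closing : Adj G (f (fromℕ M)) (f zero))
           (u : Fin n) where

    private
      avoids : ∀ {t} → f t ≢ u → f t ∈ ∁ ⁅ u ⁆
      avoids = x∉p⇒x∈∁p ∘ x≢y⇒x∉⁅y⁆

      same-index : ∀ {s t} → f s ≡ u → f t ≡ u → s ≡ t
      same-index fs≡u ft≡u = f-inj (trans fs≡u (sym ft≡u))

      reach-end : ∀ i → f i ≢ u → Reach G (∁ ⁅ u ⁆) (f zero) (f i) ⊎ Reach G (∁ ⁅ u ⁆) (f i) (f (fromℕ M))
      reach-end i fi≢u with any? (λ t → f t ≟ u)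
      ... | no u∉f = inj₁ (prefix-reach f adj i λ t _ → avoids λ ft≡u → u∉f (t , ft≡u))
      ... | yes (t , ft≡u) with <-cmp t i
      ...   | tri< t<i _ _ =
        inj₂ (suffix-reach f adj i λ s i≤s → avoids λ fs≡u →
               <⇒≱ t<i (subst (λ s → toℕ i ≤ toℕ s) (same-index fs≡u ft≡u) i≤s))
      ...   | tri≈ _ t≡i _ = ⊥-elim (fi≢u (subst (λ s → f s ≡ u) t≡i ft≡u))
      ...   | tri> _ _ i<t =
        inj₁ (prefix-reach f adj i λ s s≤i → avoids λ fs≡u →
               <⇒≱ i<t (subst (λ s → toℕ s ≤ toℕ i) (same-index fs≡u ft≡u) s≤i))

      last→first : f (fromℕ M) ∈ ∁ ⁅ u ⁆ → f zero ∈ ∁ ⁅ u ⁆ → Reach G (∁ ⁅ u ⁆) (f (fromℕ M)) (f zero)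
      last→first last∈ first∈ = step (here last∈) closing first∈

    cycle-minus-vertex-connected : ∀ i j → f i ≢ u → f j ≢ u → Reach G (∁ ⁅ u ⁆) (f i) (f j)
    cycle-minus-vertex-connected i j fi≢u fj≢u with reach-end i fi≢u | reach-end j fj≢u
    ... | inj₁ p | inj₁ q = Reach-trans (Reach-sym p) q
    ... | inj₂ p | inj₂ q = Reach-trans p (Reach-sym q)
    ... | inj₁ p | inj₂ q =
      Reach-trans (Reach-sym p) (Reach-sym (Reach-trans q (last→first (Reach-target∈ q) (Reach-source∈ p))))
    ... | inj₂ p | inj₁ q = Reach-trans p (Reach-trans (last→first (Reach-target∈ p) (Reach-source∈ q)) q)

  module _ {S V₂ : Subset n}
           (V₂-def : ∀ v → (v ∈ V₂ → v ∉ S × ¬ InV₁ G S v) × (v ∉ S × ¬ InV₁ G S v → v ∈ V₂)) where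

    V₂⊆∁S : V₂ ⊆ ∁ S
    V₂⊆∁S v∈V₂ = x∉p⇒x∈∁p (proj₁ (proj₁ (V₂-def _) v∈V₂))

    -- A vertex reachable from C in G - S lying in a big clique component would drag C into that component.
    V₂-component⇒component : ∀ {C} → IsComponent G V₂ C → IsComponent G (∁ S) C
    V₂-component⇒component {C} C-comp = component-extend C-comp V₂⊆∁S stays
      where
      stays : ∀ {v w} → v ∈ C → Reach G (∁ S) v w → w ∈ V₂
      stays v∈C p = proj₂ (V₂-def _) (x∈∁p⇒x∉p (Reach-target∈ p) , λ (D , D-comp , clique , 3≤∣D∣ , w∈D) →
        proj₂ (proj₁ (V₂-def _) (Component.⊆U C-comp v∈C))
              (D , D-comp , clique , 3≤∣D∣ , Component.closed D-comp w∈D (Reach-sym p)))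

    V₂-component-acyclic : ∀ {C} → IsCTDS G ⊤ S → IsComponent G V₂ C → ¬ HasCycle G C
    V₂-component-acyclic {C} (_ , _ , S-comps) C-comp cycle
      with S-comps C (subst (λ U → IsComponent G U C) (sym (∩-identityˡ (∁ S)))
                            (V₂-component⇒component C-comp))
    ... | inj₂ (_ , _ , acyclic) = acyclic cycle
    ... | inj₁ clique =
      proj₂ (proj₁ (V₂-def root) (⊆U root∈))
            (C , V₂-component⇒component C-comp , clique , cycle⇒3≤∣∣ cycle , root∈)
      where open Component C-comp

  module _ {C : Subset n} {u : Fin n} (u∈C : u ∈ C)
           (boundary : ∀ {a b} → a ∈ C - u → b ∉ C - u → Adj G a b → b ≡ u) where

    u∉C-u : u ∉ C - u
    u∉C-u u∈C-u = x∈p-y⇒x≢y u∈C-u refl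

    ∈C-u⇒∈C : ∀ {v} → v ∈ C - u → v ∈ C
    ∈C-u⇒∈C = p─q⊆p C ⁅ u ⁆

    edge-sides : ∀ {a b} → Adj G a b → (a ∈ C × b ∈ C) ⊎ (a ∉ C - u × b ∉ C - u)
    edge-sides {a} {b} e with a ∈? C - u | b ∈? C - u
    ... | yes a∈ | yes b∈ = inj₁ (∈C-u⇒∈C a∈ , ∈C-u⇒∈C b∈)
    ... | yes a∈ | no  b∉ = inj₁ (∈C-u⇒∈C a∈ , subst (_∈ C) (sym (boundary a∈ b∉ e)) u∈C)
    ... | no  a∉ | yes b∈ = inj₁ (subst (_∈ C) (sym (boundary b∈ a∉ (Adj-sym e))) u∈C , ∈C-u⇒∈C b∈)
    ... | no  a∉ | no  b∉ = inj₂ (a∉ , b∉)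

    Reach-preserves-∈ : ∀ {W a b} → u ∉ W → Reach G W a b → a ∈ C - u → b ∈ C - u
    Reach-preserves-∈ u∉W (here _) a∈ = a∈
    Reach-preserves-∈ u∉W (step {w = w} p e w∈W) a∈ with w ∈? C - u
    ... | yes w∈ = w∈
    ... | no  w∉ = contradiction (subst (_∈ _) (boundary (Reach-preserves-∈ u∉W p a∈) w∉ e) w∈W) u∉W

    Reach-preserves-∉ : ∀ {W a b} → u ∉ W → Reach G W a b → a ∉ C - u → b ∉ C - u
    Reach-preserves-∉ u∉W p a∉ b∈ = a∉ (Reach-preserves-∈ u∉W (Reach-sym p) b∈)

    -- Restart the walk at its last visit to u: after that it never enters C - u.
    Reach-avoiding : ∀ {W v} → Reach G W u v → v ∉ C - u → Reach G (∁ (C - u) ∩ W) u v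
    Reach-avoiding (here u∈W) _ = here (x∈p∩q⁺ (x∉p⇒x∈∁p u∉C-u , u∈W))
    Reach-avoiding (step {v = w} p e v∈W) v∉ with w ∈? C - u
    ... | yes w∈ =
      subst (Reach G _ u) (sym (boundary w∈ v∉ e)) (here (x∈p∩q⁺ (x∉p⇒x∈∁p u∉C-u , Reach-source∈ p)))
    ... | no  w∉ = step (Reach-avoiding p w∉) e (x∈p∩q⁺ (x∉p⇒x∈∁p v∉ , v∈W))

    module _ {M} {f : Fin (suc (suc M)) → Fin n} (f-inj : Injective _≡_ _≡_ f)
             (adj : ∀ i → Adj G (f (inject₁ i)) (f (suc i)))
             (closing : Adj G (f (fromℕ (suc M))) (f zero)) where

      private
        u∉∁⁅u⁆ : u ∉ ∁ ⁅ u ⁆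
        u∉∁⁅u⁆ u∈∁⁅u⁆ = x∈∁p⇒x∉p u∈∁⁅u⁆ (x∈⁅x⁆ u)

        side-of : ∀ i₀ → f i₀ ≢ u → (∀ i → f i ∈ C) ⊎ (∀ i → f i ∉ C - u)
        side-of i₀ fi₀≢u with f i₀ ∈? C - u
        ... | yes fi₀∈ = inj₁ in-C
          where
          in-C : ∀ i → f i ∈ C
          in-C i with f i ≟ u
          ... | yes fi≡u = subst (_∈ C) (sym fi≡u) u∈C
          ... | no  fi≢u = ∈C-u⇒∈C (Reach-preserves-∈ u∉∁⁅u⁆
                             (cycle-minus-vertex-connected f-inj adj closing u i₀ i fi₀≢u fi≢u) fi₀∈)
        ... | no  fi₀∉ = inj₂ out
          where
          out : ∀ i → f i ∉ C - u
          out i with f i ≟ u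
          ... | yes fi≡u = subst (_∉ C - u) (sym fi≡u) u∉C-u
          ... | no  fi≢u = Reach-preserves-∉ u∉∁⁅u⁆
                             (cycle-minus-vertex-connected f-inj adj closing u i₀ i fi₀≢u fi≢u) fi₀∉

      cycle-on-one-side : (∀ i → f i ∈ C) ⊎ (∀ i → f i ∉ C - u)
      cycle-on-one-side with f zero ≟ u
      ... | no  f0≢u = side-of zero f0≢u
      ... | yes f0≡u = side-of (suc zero) λ f1≡u → contradiction (f-inj (trans f0≡u (sym f1≡u))) λ ()

    cycle-splits : ∀ {D} → HasCycle G D → HasCycle G C ⊎ HasCycle G (D ∩ ∁ (C - u))
    cycle-splits (l , f , f-inj , f∈D , adj , closing) with cycle-on-one-side f-inj adj closing
    ... | inj₁ f∈C = inj₁ (l , f , f-inj , f∈C , adj , closing)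
    ... | inj₂ f∉  = inj₂ (l , f , f-inj , (λ i → x∈p∩∁q⁺ (f∈D i) (f∉ i)) , adj , closing)

    module _ {x : Fin n} (C-simple : IsSimple G C) (C-acyclic : ¬ HasCycle G C)
             (C-connected : ∀ {a b} → a ∈ C → b ∈ C → Reach G C a b)
             (hub : ∀ {v} → v ∉ C → Adj G u v → v ≡ x) where

      module _ {X : Subset n} (X-ctds : IsCTDS G (∁ (C - u)) X) where

        private
          X⊆ : X ⊆ ∁ (C - u)
          X⊆ = proj₁ X-ctds

          X-simple : IsSimple G (∁ (C - u) ∩ ∁ X)
          X-simple = proj₁ (proj₂ X-ctds)

          X-comps : ∀ D → IsComponent G (∁ (C - u) ∩ ∁ X) D → IsClique G D ⊎ IsTree G D
          X-comps = proj₂ (proj₂ X-ctds)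

          remains : ∀ {v} → v ∉ C - u → v ∈ ∁ X → v ∈ ∁ (C - u) ∩ ∁ X
          remains v∉ v∈∁X = x∈p∩q⁺ (x∉p⇒x∈∁p v∉ , v∈∁X)

          simple : IsSimple G (∁ X)
          simple = no-loop , no-parallel
            where
            no-loop : ∀ v → v ∈ ∁ X → mult G v v ≡ 0
            no-loop v v∈ with v ∈? C - u
            ... | yes v∈C-u = proj₁ C-simple v (∈C-u⇒∈C v∈C-u)
            ... | no  v∉C-u = proj₁ X-simple v (remains v∉C-u v∈)

            no-parallel : ∀ a b → a ∈ ∁ X → b ∈ ∁ X → mult G a b ≤ 1
            no-parallel a b a∈ b∈ with Adj? a b
            ... | no  ¬e = ≤-trans (≮⇒≥ ¬e) z≤n
            ... | yes e with edge-sides e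
            ...   | inj₁ (a∈C , b∈C) = proj₂ C-simple a b a∈C b∈C
            ...   | inj₂ (a∉ , b∉)   = proj₂ X-simple a b (remains a∉ a∈) (remains b∉ b∈)

          component-disjoint : ∀ {D} → IsComponent G (∁ X) D → (∀ {v} → v ∈ D → v ∉ C - u) →
                               IsClique G D ⊎ IsTree G D
          component-disjoint {D} D-comp D∩C-u≡∅ =
            X-comps D (component-restrict D-comp (λ v∈D → remains (D∩C-u≡∅ v∈D) (⊆U v∈D)) (p∩q⊆q _ _))
            where open Component D-comp

          component-inside : ∀ {D p} → u ∈ X → IsComponent G (∁ X) D → p ∈ D → p ∈ C - u → IsTree G D
          component-inside {D} u∈X D-comp p∈D p∈ =
            acyclic-component⇒tree D-comp (C-acyclic ∘ HasCycle-mono (∈C-u⇒∈C ∘ D⊆C-u))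
            where
            open Component D-comp
            D⊆C-u : ∀ {v} → v ∈ D → v ∈ C - u
            D⊆C-u v∈D =
              Reach-preserves-∈ (λ u∈∁X → x∈∁p⇒x∉p u∈∁X u∈X) (Reach-mono ⊆U (connected p∈D v∈D)) p∈

          component-through-u : ∀ {D p} → u ∉ X → IsComponent G (∁ X) D → p ∈ D → p ∈ C - u → IsTree G D
          component-through-u {D} u∉X D-comp p∈D p∈ = acyclic-component⇒tree D-comp acyclic
            where
            open Component D-comp

            C⊆∁X : C ⊆ ∁ X
            C⊆∁X {v} v∈C with v ≟ u
            ... | yes refl = x∉p⇒x∈∁p u∉X
            ... | no  v≢u  = x∉p⇒x∈∁p λ v∈X → x∈∁p⇒x∉p (X⊆ v∈X) (x∈p∧x≢y⇒x∈p-y v∈C v≢u)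

            u∈D : u ∈ D
            u∈D = closed p∈D (Reach-mono C⊆∁X (C-connected (∈C-u⇒∈C p∈) u∈C))

            E : Subset n
            E = D ∩ ∁ (C - u)

            E-comp : IsComponent G (∁ (C - u) ∩ ∁ X) E
            E-comp = u , x∈p∩∁q⁺ u∈D u∉C-u , λ v → to-E , from-E
              where
              to-E : ∀ {v} → v ∈ E → Reach G (∁ (C - u) ∩ ∁ X) u v
              to-E v∈E = let v∈D , v∉ = x∈p∩∁q⁻ v∈E in Reach-avoiding (Reach-mono ⊆U (connected u∈D v∈D)) v∉
              from-E : ∀ {v} → Reach G (∁ (C - u) ∩ ∁ X) u v → v ∈ E
              from-E p = x∈p∩∁q⁺ (closed u∈D (Reach-mono (p∩q⊆q _ _) p))
                                 (x∈∁p⇒x∉p (proj₁ (x∈p∩q⁻ _ _ (Reach-target∈ p))))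

            clique⊆⁅u⁆∪⁅x⁆ : IsClique G E → E ⊆ ⁅ u ⁆ ∪ ⁅ x ⁆
            clique⊆⁅u⁆∪⁅x⁆ clique {v} v∈E with v ≟ u
            ... | yes refl = x∈p∪q⁺ (inj₁ (x∈⁅x⁆ u))
            ... | no  v≢u  = x∈p∪q⁺ (inj₂ (subst (_∈ ⁅ x ⁆) (sym v≡x) (x∈⁅x⁆ x)))
              where
              v∉C : v ∉ C
              v∉C v∈C = proj₂ (x∈p∩∁q⁻ v∈E) (x∈p∧x≢y⇒x∈p-y v∈C v≢u)
              v≡x : v ≡ x
              v≡x = hub v∉C (clique u v (x∈p∩∁q⁺ u∈D u∉C-u) v∈E (v≢u ∘ sym))

            clique-acyclic : IsClique G E → ¬ HasCycle G E
            clique-acyclic clique cycle = contradiction 3≤2 λ { (s≤s (s≤s ())) }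
              where
              open ≤-Reasoning
              3≤2 : 3 ≤ 2
              3≤2 = begin
                3                      ≤⟨ cycle⇒3≤∣∣ cycle ⟩
                ∣ E ∣                  ≤⟨ p⊆q⇒∣p∣≤∣q∣ (clique⊆⁅u⁆∪⁅x⁆ clique) ⟩
                ∣ ⁅ u ⁆ ∪ ⁅ x ⁆ ∣      ≤⟨ ∣p∪q∣≤∣p∣+∣q∣ ⁅ u ⁆ ⁅ x ⁆ ⟩
                ∣ ⁅ u ⁆ ∣ + ∣ ⁅ x ⁆ ∣  ≡⟨ cong₂ _+_ (∣⁅x⁆∣≡1 u) (∣⁅x⁆∣≡1 x) ⟩
                2                      ∎

            acyclic : ¬ HasCycle G D
            acyclic cycle with cycle-splits cycle
            ... | inj₁ cycle-in-C = C-acyclic cycle-in-C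
            ... | inj₂ cycle-in-E with X-comps E E-comp
            ...   | inj₂ (_ , _ , E-acyclic) = E-acyclic cycle-in-E
            ...   | inj₁ clique            = clique-acyclic clique cycle-in-E

          components : ∀ D → IsComponent G (∁ X) D → IsClique G D ⊎ IsTree G D
          components D D-comp with any? (λ v → v ∈? D ×-dec v ∈? C - u)
          ... | no  D∩C-u≡∅ = component-disjoint D-comp λ v∈D v∈ → D∩C-u≡∅ (_ , v∈D , v∈)
          ... | yes (p , p∈D , p∈) with u ∈? X
          ...   | yes u∈X = inj₂ (component-inside u∈X D-comp p∈D p∈)
          ...   | no  u∉X = inj₂ (component-through-u u∉X D-comp p∈D p∈)

        IsCTDS-pendant-lift : IsCTDS G ⊤ X
        IsCTDS-pendant-lift =
          (λ _ → ∈⊤) , subst (IsSimple G) (sym (∩-identityˡ (∁ X))) simple ,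
          λ D D-comp → components D (subst (λ U → IsComponent G U D) (∩-identityˡ (∁ X)) D-comp)

      YesInstance-pendant-lift : ∀ {k} → YesInstance G (∁ (C - u)) k → YesInstance G ⊤ k
      YesInstance-pendant-lift (X , X-ctds , X≤k) = X , IsCTDS-pendant-lift X-ctds , X≤k

lemma26 : ∀ {n} (G : MultiGraph n) (k : ℕ) (S : Subset n) →
    IsCTDS G ⊤ S → ∣ S ∣ ≤ 4 * k →
    (V₂ : Subset n) → (∀ v → (v ∈ V₂ → v ∉ S × ¬ InV₁ G S v) × (v ∉ S × ¬ InV₁ G S v → v ∈ V₂)) →
    (C : Subset n) → IsComponent G V₂ C →
    (x u : Fin n) → x ∈ S → u ∈ C →
    (∀ v → ((v ∉ C × ∃ λ w → w ∈ C × Adj G v w) → v ≡ x) × (v ≡ x → v ∉ C × ∃ λ w → w ∈ C × Adj G v w)) →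
    (∀ v → ((v ∈ C × Adj G x v) → v ≡ u) × (v ≡ u → v ∈ C × Adj G x v)) →
    YesInstance G ⊤ k ⇔ YesInstance G (∁ (C - u)) k
lemma26 G _ S S-ctds _ V₂ V₂-def C C-comp x u _ u∈C N[C]≡x N[x]∩C≡u =
  mk⇔ (YesInstance-mono G (λ _ → ∈⊤))
      (YesInstance-pendant-lift G u∈C boundary C-simple C-acyclic (Component.connected G C-comp) hub)
  where
  C-simple : IsSimple G C
  C-simple = IsSimple-mono G (V₂⊆∁S G V₂-def ∘ Component.⊆U G C-comp)
                             (subst (IsSimple G) (∩-identityˡ (∁ S)) (proj₁ (proj₂ S-ctds)))

  C-acyclic : ¬ HasCycle G C
  C-acyclic = V₂-component-acyclic G V₂-def S-ctds C-comp

  hub : ∀ {v} → v ∉ C → Adj G u v → v ≡ x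
  hub v∉C e = proj₁ (N[C]≡x _) (v∉C , u , u∈C , Adj-sym G e)

  boundary : ∀ {a b} → a ∈ C - u → b ∉ C - u → Adj G a b → b ≡ u
  boundary {a} {b} a∈ b∉ e with b ≟ u | b ∈? C
  ... | yes b≡u | _       = b≡u
  ... | no  b≢u | yes b∈C = contradiction (x∈p∧x≢y⇒x∈p-y b∈C b≢u) b∉
  ... | no  _   | no  b∉C = contradiction a≡u (x∈p-y⇒x≢y a∈)
    where
    b≡x : b ≡ x
    b≡x = proj₁ (N[C]≡x b) (b∉C , a , p─q⊆p C ⁅ u ⁆ a∈ , Adj-sym G e)
    a≡u : a ≡ u
    a≡u = proj₁ (N[x]∩C≡u a) (p─q⊆p C ⁅ u ⁆ a∈ , subst (λ y → Adj G y a) b≡x (Adj-sym G e))
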